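{- Let $n \ge 2$. Then $\Gamma(G_n) \ge 2n-9$. Moreover, $$\Gamma(G_n) \ge \begin{cases} 2n-6, & \text{if } n \equiv 0 \text{ or } 1 \pmod 4,\\ 2n-7, & \text{if } n \equiv 2 \pmod 4,\\ 2n-9, & \text{if } n \equiv 3 \pmod 4.\end{cases}$$
   Context: For a finite simple graph $G$ and $k \in \mathbb{N}$, a $k$-complete coloring of $G$ is a map $c: V(G) \to [k] = \{1,\dots,k\}$ such that for every pair of distinct colors $i \ne j$ in $[k]$ there is an edge $\{u,v\} \in E(G)$ with $c(u)=i$ and $c(v)=j$ (adjacent vertices may receive the same color). The complete coloring number $\Gamma(G)$ is the largest $k$ for which a $k$-complete coloring of $G$ exists. $G_n$ denotes the $n \times n$ square grid graph: vertices $(i,j) \in \mathbb{Z}^2$ with $1 \le i,j \le n$, and $(i_1,j_1) \sim (i_2,j_2)$ iff $|i_1-i_2|+|j_1-j_2| = 1$. -}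

module Defs where

open import Data.Nat using (ℕ; suc; _+_; _*_; _∸_; _≤_; _%_)
open import Data.Fin using (Fin; toℕ)
open import Data.Product using (_×_; Σ; ∃; _,_)
open import Data.Sum using (_⊎_)
open import Relation.Binary.PropositionalEquality using (_≡_)
open import Relation.Nullary using (¬_)

Vertex : ℕ → Set
Vertex n = Fin n × Fin n

Nbr : ℕ → ℕ → Set
Nbr a b = (suc a ≡ b) ⊎ (suc b ≡ a)

Adj : (n : ℕ) → Vertex n → Vertex n → Set
Adj n (i₁ , j₁) (i₂ , j₂) =
  (toℕ i₁ ≡ toℕ i₂ × Nbr (toℕ j₁) (toℕ j₂)) ⊎
  (toℕ j₁ ≡ toℕ j₂ × Nbr (toℕ i₁) (toℕ i₂))

IsCompleteColoring : (n k : ℕ) → (Vertex n → Fin k) → Set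
IsCompleteColoring n k c =
  (a b : Fin k) → ¬ (a ≡ b) →
  Σ (Vertex n) λ u → Σ (Vertex n) λ v → Adj n u v × c u ≡ a × c v ≡ b

-- Γ(G_n) ≥ m  :⇔  there is a k-complete coloring for some k ≥ m
-- (Γ is the largest such k).
ΓAtLeast : ℕ → ℕ → Set
ΓAtLeast n m = ∃ λ k → m ≤ k × Σ (Vertex n → Fin k) (IsCompleteColoring n k)

-- The case-dependent lower bound of the theorem (truncated subtraction;
-- negative bounds are vacuous anyway).
bound : ℕ → ℕ
bound n with n % 4
... | 0 = 2 * n ∸ 6
... | 1 = 2 * n ∸ 6
... | 2 = 2 * n ∸ 7
... | _ = 2 * n ∸ 9

module Submission where

-- For n = m + 3 with m ≥ 1 we exhibit a complete colouring of the grid G_n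
-- with k = 2m = 2n - 6 colours; this dominates every bound in the theorem,
-- and for n = 2, 3 all the bounds are 0.
--
-- The colouring is constant along cyclic diagonals up to a shift.  A cell lies
-- on the diagonal g = j - i (mod n) at some position t, and is coloured
-- offset(g) + t (mod k).  Every horizontal edge of the grid joins diagonal
-- coordinates (g , t) and (g + 1 , t), every vertical edge joins (g + 1 , t)
-- and (g , t + 1).  So each diagonal g yields a "run": colours c and c + d are
-- adjacent for m + 2 (horizontal) or m + 1 (vertical) consecutive colours c,
-- where d is the gap offset(g + 1) - offset(g) (minus one, for vertical
-- edges).  The offsets are chosen so that for every d ≤ m two runs of gap d
-- together cover all k residues; then any two colours are adjacent.

open import Defs
open import Data.Nat using (ℕ; zero; suc; _+_; _*_; _∸_; _≤_; _<_; _%_; z≤n; s≤s; NonZero; _≤?_; _<?_)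
open import Data.Nat.Properties
open import Data.Nat.DivMod using (_mod_; %-distribˡ-+; m%n%n≡m%n; [m+n]%n≡m%n; m%n<n; m%n≤n; m<n⇒m%n≡m)
open import Data.Nat.Tactic.RingSolver using (solve-∀)
open import Data.Fin using (Fin; toℕ; fromℕ<)
open import Data.Fin.Properties using (toℕ-fromℕ<; toℕ-injective; toℕ<n)
open import Data.Product using (_×_; Σ; _,_)
open import Data.Sum using (inj₁; inj₂)
open import Data.Empty using (⊥-elim)
open import Relation.Binary.PropositionalEquality
open import Relation.Binary.Definitions using (tri<; tri≈; tri>)
open import Relation.Nullary using (yes; no)

+-swapʳ : ∀ x y z → x + y + z ≡ x + z + y
+-swapʳ = solve-∀

+-swapˡ : ∀ x y z → x + (y + z) ≡ y + (x + z)
+-swapˡ = solve-∀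

nbr-sym : ∀ {a b} → Nbr a b → Nbr b a
nbr-sym (inj₁ e) = inj₂ e
nbr-sym (inj₂ e) = inj₁ e

adj-sym : ∀ {n} (u v : Vertex n) → Adj n u v → Adj n v u
adj-sym _ _ (inj₁ (e , d)) = inj₁ (sym e , nbr-sym d)
adj-sym _ _ (inj₂ (e , d)) = inj₂ (sym e , nbr-sym d)

-- Cyclic diagonal coordinates (g , t) of the cell in row i, column j:
-- above the main diagonal g = j - i and t = i; below it the diagonal wraps
-- around, g = n + j - i and t = i - 1.
diagonal : (n i j : ℕ) → ℕ × ℕ
diagonal n i j with i ≤? j
... | yes _ = j ∸ i , i
... | no _ = n + j ∸ i , i ∸ 1

coord : (n : ℕ) → Vertex n → ℕ × ℕ
coord n (i , j) = diagonal n (toℕ i) (toℕ j)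

diagonal-upper : ∀ n t g → diagonal n t (t + g) ≡ (g , t)
diagonal-upper n t g with t ≤? t + g
... | yes _ = cong (_, t) (m+n∸m≡n t g)
... | no t≰t+g = ⊥-elim (t≰t+g (m≤m+n t g))

diagonal-lower : ∀ n t g j → j ≤ t → n + j ≡ suc t + g → diagonal n (suc t) j ≡ (g , t)
diagonal-lower n t g j j≤t n+j≡ with suc t ≤? j
... | yes t<j = ⊥-elim (<⇒≱ t<j j≤t)
... | no _ = cong (_, t) (trans (cong (_∸ suc t) n+j≡) (m+n∸m≡n (suc t) g))

wrap-≤ : ∀ {n j t g} → g < n → n + j ≡ suc t + g → j ≤ t
wrap-≤ {n} {j} {t} {g} g<n n+j≡ = +-cancelˡ-≤ n j t (begin
    n + j     ≡⟨ n+j≡ ⟩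
    suc t + g ≡⟨ sym (+-suc t g) ⟩
    t + suc g ≤⟨ +-monoʳ-≤ t g<n ⟩
    t + n     ≡⟨ +-comm t n ⟩
    n + t     ∎)
  where open ≤-Reasoning

EdgeBetween : (n : ℕ) → ℕ × ℕ → ℕ × ℕ → Set
EdgeBetween n p q = Σ (Vertex n) λ u → Σ (Vertex n) λ v → Adj n u v × coord n u ≡ p × coord n v ≡ q

cell : ∀ {n i j} → i < n → j < n → Vertex n
cell i<n j<n = fromℕ< i<n , fromℕ< j<n

coord-cell : ∀ {n i j} (i<n : i < n) (j<n : j < n) → coord n (cell i<n j<n) ≡ diagonal n i j
coord-cell i<n j<n = cong₂ (diagonal _) (toℕ-fromℕ< i<n) (toℕ-fromℕ< j<n)

nbr-suc : ∀ {n j} (j<n : j < n) (j+1<n : suc j < n) → Nbr (toℕ (fromℕ< j<n)) (toℕ (fromℕ< j+1<n))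
nbr-suc j<n j+1<n = inj₁ (trans (cong suc (toℕ-fromℕ< j<n)) (sym (toℕ-fromℕ< j+1<n)))

horizontal-edge : ∀ {n i j p q} (i<n : i < n) (j+1<n : suc j < n) →
                  diagonal n i j ≡ p → diagonal n i (suc j) ≡ q → EdgeBetween n p q
horizontal-edge i<n j+1<n ep eq =
  cell i<n j<n , cell i<n j+1<n , inj₁ (refl , nbr-suc j<n j+1<n) ,
  trans (coord-cell i<n j<n) ep , trans (coord-cell i<n j+1<n) eq
  where j<n = <-trans (n<1+n _) j+1<n

vertical-edge : ∀ {n i j p q} (i+1<n : suc i < n) (j<n : j < n) →
                diagonal n i j ≡ p → diagonal n (suc i) j ≡ q → EdgeBetween n p q
vertical-edge i+1<n j<n ep eq =
  cell i<n j<n , cell i+1<n j<n , inj₂ (refl , nbr-suc i<n i+1<n) ,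
  trans (coord-cell i<n j<n) ep , trans (coord-cell i+1<n j<n) eq
  where i<n = <-trans (n<1+n _) i+1<n

horizontal-step : ∀ {n} g t → suc g < n → suc t < n → EdgeBetween n (g , t) (suc g , t)
horizontal-step {n} g t g+1<n t+1<n with suc (suc t + g) ≤? n
... | yes t+g+1<n =
  horizontal-edge (<-trans (n<1+n t) t+1<n) t+g+1<n (diagonal-upper n t g)
    (trans (cong (diagonal n t) (sym (+-suc t g))) (diagonal-upper n t (suc g)))
... | no t+g+1≮n with m≤n⇒∃[o]m+o≡n (≤-pred (≰⇒> t+g+1≮n))
...   | j , n+j≡ = horizontal-edge t+1<n (<-trans (s≤s j+1≤t) t+1<n)
          (diagonal-lower n t g j (≤-trans (n≤1+n j) j+1≤t) n+j≡)
          (diagonal-lower n t (suc g) (suc j) j+1≤t n+j+1≡)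
  where
    n+j+1≡ : n + suc j ≡ suc t + suc g
    n+j+1≡ = trans (+-suc n j) (trans (cong suc n+j≡) (sym (+-suc (suc t) g)))
    j+1≤t : suc j ≤ t
    j+1≤t = wrap-≤ g+1<n n+j+1≡

vertical-step : ∀ {n} g t → suc g < n → suc (suc t) < n → EdgeBetween n (suc g , t) (g , suc t)
vertical-step {n} g t g+1<n t+2<n with suc (t + suc g) ≤? n
... | yes t+g+1<n =
  vertical-edge (<-trans (n<1+n (suc t)) t+2<n) t+g+1<n (diagonal-upper n t (suc g))
    (trans (cong (diagonal n (suc t)) (+-suc t g)) (diagonal-upper n (suc t) g))
... | no t+g+1≮n with m≤n⇒∃[o]m+o≡n (<⇒≤ (≰⇒> t+g+1≮n))
...   | j , n+j≡ = vertical-edge t+2<n (≤-<-trans j≤t (<-trans (n<1+n t) (<-trans (n<1+n (suc t)) t+2<n)))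
          (diagonal-lower n t (suc g) j j≤t n+j≡)
          (diagonal-lower n (suc t) g j (≤-trans j≤t (n≤1+n t)) (trans n+j≡ (+-suc (suc t) g)))
  where
    j≤t : j ≤ t
    j≤t = wrap-≤ g+1<n n+j≡

complement-small : ∀ {D k} → D ≤ k → k < D + D → (k ∸ D) + (k ∸ D) ≤ k
complement-small {D} {k} D≤k k<2D = begin
    E + E ≤⟨ +-monoʳ-≤ E (<⇒≤ E<D) ⟩
    E + D ≡⟨ +-comm E D ⟩
    D + E ≡⟨ D+E≡k ⟩
    k     ∎
  where
    open ≤-Reasoning
    E = k ∸ D
    D+E≡k : D + E ≡ k
    D+E≡k = m+[n∸m]≡n D≤k
    E<D : E < D
    E<D = +-cancelˡ-< D E D (subst (_< D + D) (sym D+E≡k) k<2D)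

module Modular (k : ℕ) {{_ : NonZero k}} where

  %-absorbʳ : ∀ x y → (x + y % k) % k ≡ (x + y) % k
  %-absorbʳ x y = begin
    (x + y % k) % k         ≡⟨ %-distribˡ-+ x (y % k) k ⟩
    (x % k + y % k % k) % k ≡⟨ cong (λ z → (x % k + z) % k) (m%n%n≡m%n y k) ⟩
    (x % k + y % k) % k     ≡⟨ sym (%-distribˡ-+ x y k) ⟩
    (x + y) % k             ∎
    where open ≡-Reasoning

  %-absorbˡ : ∀ x y → (x % k + y) % k ≡ (x + y) % k
  %-absorbˡ x y = trans (cong (_% k) (+-comm (x % k) y))
                    (trans (%-absorbʳ y x) (cong (_% k) (+-comm y x)))

  +-cong-% : ∀ {x y} z → x % k ≡ y % k → (x + z) % k ≡ (y + z) % k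
  +-cong-% {x} {y} z e =
    trans (sym (%-absorbˡ x z)) (trans (cong (λ w → (w + z) % k) e) (%-absorbˡ y z))

  complement-% : ∀ x {D} → D ≤ k → (x + D + (k ∸ D)) % k ≡ x % k
  complement-% x {D} D≤k =
    trans (cong (_% k) (trans (+-assoc x D (k ∸ D)) (cong (x +_) (m+[n∸m]≡n D≤k))))
          ([m+n]%n≡m%n x k)

module Residues (n k : ℕ) {{_ : NonZero k}} (label : Vertex n → ℕ) where
  open Modular k

  colour : Vertex n → Fin k
  colour v = label v mod k

  record Joined (x y : ℕ) : Set where
    constructor joined
    field
      u v : Vertex n
      u~v : Adj n u v
      colour-u : label u % k ≡ x % k
      colour-v : label v % k ≡ y % k

  joined-sym : ∀ {x y} → Joined x y → Joined y x
  joined-sym (joined u v uv lu lv) = joined v u (adj-sym u v uv) lv lu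

  joined-resp : ∀ {x x′ y y′} → x % k ≡ x′ % k → y % k ≡ y′ % k → Joined x y → Joined x′ y′
  joined-resp ex ey (joined u v uv lu lv) = joined u v uv (trans lu ex) (trans lv ey)

  record Run (D B L : ℕ) : Set where
    constructor run
    field joined-at : ∀ t → t < L → Joined (B + t) (B + t + D)

  run-weaken : ∀ {D B L L′} → L′ ≤ L → Run D B L → Run D B L′
  run-weaken L′≤L (run r) = run λ t t<L′ → r t (<-≤-trans t<L′ L′≤L)

  run-shift : ∀ {D B B′ L} → B % k ≡ B′ % k → Run D B L → Run D B′ L
  run-shift {D} eB (run r) = run λ t t<L →
    joined-resp (+-cong-% t eB) (+-cong-% D (+-cong-% t eB)) (r t t<L)

  run-append : ∀ {D B L₁ L₂} → Run D B L₁ → Run D (B + L₁) L₂ → Run D B (L₁ + L₂)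
  run-append {D} {B} {L₁} (run first) (run second) = run joined-at
    where
      joined-at : ∀ t → t < L₁ + _ → Joined (B + t) (B + t + D)
      joined-at t t<L with t <? L₁
      ... | yes t<L₁ = first t t<L₁
      ... | no t≮L₁ with m≤n⇒∃[o]m+o≡n (≮⇒≥ t≮L₁)
      ...   | s , refl = subst (λ x → Joined x (x + D)) (+-assoc B L₁ s)
                           (second s (+-cancelˡ-< L₁ s _ t<L))

  -- Read backwards, a run of gap D is a run of gap k - D.
  run-flip : ∀ {D B L} → D ≤ k → Run D B L → Run (k ∸ D) (B + D) L
  run-flip {D} {B} D≤k (run r) = run λ t t<L → joined-resp
    (cong (_% k) (+-swapʳ B t D))
    (sym (trans (cong (λ x → (x + (k ∸ D)) % k) (+-swapʳ B D t)) (complement-% (B + t) D≤k)))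
    (joined-sym (r t t<L))

  run-cover : ∀ {D B L} → Run D B L → k ≤ L → ∀ a → Joined a (a + D)
  run-cover {D} {B} (run joined-at) k≤L a =
    joined-resp hit (+-cong-% D hit) (joined-at t (<-≤-trans (m%n<n _ k) k≤L))
    where
      r = B % k
      t = (a + (k ∸ r)) % k
      hit : (B + t) % k ≡ a % k
      hit = begin
        (B + t) % k               ≡⟨ %-absorbʳ B (a + (k ∸ r)) ⟩
        (B + (a + (k ∸ r))) % k   ≡⟨ sym (%-absorbˡ B (a + (k ∸ r))) ⟩
        (r + (a + (k ∸ r))) % k   ≡⟨ cong (_% k) (+-swapˡ r a (k ∸ r)) ⟩
        (a + (r + (k ∸ r))) % k   ≡⟨ cong (λ z → (a + z) % k) (m+[n∸m]≡n (m%n≤n B k)) ⟩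
        (a + k) % k               ≡⟨ [m+n]%n≡m%n a k ⟩
        a % k                     ∎
        where open ≡-Reasoning

  -- Gaps up to k/2 suffice: a larger gap b - a is handled from b with gap k - (b - a).
  joined-ordered : (∀ D → 0 < D → D + D ≤ k → ∀ a → Joined a (a + D)) →
                   ∀ {a b} → a < b → b < k → Joined a b
  joined-ordered gaps {a} {b} a<b b<k with (b ∸ a) + (b ∸ a) ≤? k
  ... | yes small = subst (Joined a) (m+[n∸m]≡n (<⇒≤ a<b)) (gaps (b ∸ a) (m<n⇒0<n∸m a<b) small a)
  ... | no large = joined-sym (joined-resp refl back
                     (gaps (k ∸ D) (m<n⇒0<n∸m D<k) (complement-small (<⇒≤ D<k) (≰⇒> large)) b))
    where
      D = b ∸ a
      D<k : D < k
      D<k = ≤-<-trans (m∸n≤m b a) b<k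
      back : (b + (k ∸ D)) % k ≡ a % k
      back = trans (cong (λ x → (x + (k ∸ D)) % k) (sym (m+[n∸m]≡n (<⇒≤ a<b))))
                   (complement-% a (<⇒≤ D<k))

  colour-≡ : ∀ {v} {a : Fin k} → label v % k ≡ toℕ a % k → colour v ≡ a
  colour-≡ {v} {a} e =
    toℕ-injective (trans (toℕ-fromℕ< (m%n<n (label v) k)) (trans e (m<n⇒m%n≡m (toℕ<n a))))

  joined-edge : ∀ {a b : Fin k} → Joined (toℕ a) (toℕ b) →
                Σ (Vertex n) λ u → Σ (Vertex n) λ v → Adj n u v × colour u ≡ a × colour v ≡ b
  joined-edge (joined u v uv lu lv) = u , v , uv , colour-≡ lu , colour-≡ lv

  complete-from-gaps : (∀ D → 0 < D → D + D ≤ k → ∀ a → Joined a (a + D)) →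
                       IsCompleteColoring n k colour
  complete-from-gaps gaps a b a≢b with <-cmp (toℕ a) (toℕ b)
  ... | tri< a<b _ _ = joined-edge (joined-ordered gaps a<b (toℕ<n b))
  ... | tri≈ _ a≡b _ = ⊥-elim (a≢b (toℕ-injective a≡b))
  ... | tri> _ _ b<a = joined-edge (joined-sym (joined-ordered gaps b<a (toℕ<n a)))

-- Doubling by recursion, so that diagonal 2(q + 1) + 1 is definitionally 2q + 3.
twice : ℕ → ℕ
twice zero = 0
twice (suc q) = suc (suc (twice q))

twice-≡ : ∀ q → twice q ≡ q + q
twice-≡ zero = refl
twice-≡ (suc q) = cong suc (trans (cong suc (twice-≡ q)) (sym (+-suc q q)))

step : ℕ → ℕ → ℕ
step m 0 = 1
step m 1 = suc m
step m 2 = suc (suc m)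
step m (suc (suc (suc g))) = step m (suc g)

offset : ℕ → ℕ → ℕ
offset m 0 = 0
offset m 1 = 0
offset m (suc (suc g)) = offset m g + step m g

step-odd : ∀ m q → step m (suc (twice q)) ≡ suc m
step-odd m zero = refl
step-odd m (suc q) = step-odd m q

step-even : ∀ m q → step m (suc (suc (twice q))) ≡ suc (suc m)
step-even m zero = refl
step-even m (suc q) = step-even m q

offset-odd : ∀ m q → offset m (suc (twice q)) ≡ q * suc m
offset-odd m zero = refl
offset-odd m (suc q) =
  trans (cong₂ _+_ (offset-odd m q) (step-odd m q)) (+-comm (q * suc m) (suc m))

offset-even : ∀ m q → offset m (suc (suc (twice q))) ≡ q * suc m + suc q
offset-even m zero = refl
offset-even m (suc q) =
  trans (cong₂ _+_ (offset-even m q) (step-even m q)) (recurrence m q)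
  where
    recurrence : ∀ m q → q * suc m + suc q + suc (suc m) ≡ suc q * suc m + suc (suc q)
    recurrence = solve-∀

gap-odd : ∀ m q → offset m (suc (suc (twice q))) ≡ offset m (suc (twice q)) + suc q
gap-odd m q = trans (offset-even m q) (cong (_+ suc q) (sym (offset-odd m q)))

gap-even : ∀ {m} D q → D + q ≡ m →
           offset m (suc (suc (suc (twice q)))) ≡ offset m (suc (suc (twice q))) + D
gap-even {m} D q refl =
  trans (cong₂ _+_ (offset-odd m q) (step-odd m q))
        (trans (identity D q) (cong (_+ D) (sym (offset-even m q))))
  where
    identity : ∀ D q → q * suc (D + q) + suc (D + q) ≡ q * suc (D + q) + suc q + D
    identity = solve-∀

large-gap-room : ∀ {D p m} → suc D + p ≡ m → m < D + D → suc (suc (suc (twice p))) ≤ m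
large-gap-room {D} {p} {m} e m<2D = begin
    suc (suc (suc (twice p))) ≡⟨ cong (λ x → suc (suc (suc x))) (twice-≡ p) ⟩
    suc (suc (suc (p + p)))   ≡⟨ sym (+-suc (suc (suc p)) p) ⟩
    suc (suc p) + suc p       ≤⟨ +-monoˡ-≤ (suc p) p+1<D ⟩
    D + suc p                 ≡⟨ D+p+1≡m ⟩
    m                         ∎
  where
    open ≤-Reasoning
    D+p+1≡m : D + suc p ≡ m
    D+p+1≡m = trans (+-suc D p) e
    p+1<D : suc p < D
    p+1<D = +-cancelˡ-< D (suc p) D (subst (_< D + D) (sym D+p+1≡m) m<2D)

-- In the large-gap case the vertical run starts m - 1 colours after the
-- horizontal one, modulo 2m.
large-gap-wrap : ∀ x {D p m} → suc D + p ≡ m → x + suc (suc m) + (D + p) ≡ suc x + (m + m)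
large-gap-wrap x {D} {p} refl = identity x D p
  where
    identity : ∀ x D p → x + suc (suc (suc D + p)) + (D + p) ≡ suc x + (suc D + p + (suc D + p))
    identity = solve-∀

module Construction (m′ : ℕ) where
  m n k : ℕ
  m = suc m′
  n = suc (suc (suc m))
  k = m + m

  weight : ℕ × ℕ → ℕ
  weight (g , t) = offset m g + t

  label : Vertex n → ℕ
  label v = weight (coord n v)

  open Residues n k label public

  joined-from-edge : ∀ {p q} → EdgeBetween n p q → Joined (weight p) (weight q)
  joined-from-edge (u , v , uv , refl , refl) = joined u v uv refl refl

  horizontal-run : ∀ g D → offset m (suc g) ≡ offset m g + D → suc g < n →
                   Run D (offset m g) (suc (suc m))
  horizontal-run g D gap g+1<n = run λ t t<m+2 →
    subst (Joined (offset m g + t)) (trans (cong (_+ t) gap) (+-swapʳ (offset m g) D t))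
      (joined-from-edge (horizontal-step g t g+1<n (s≤s t<m+2)))

  vertical-run : ∀ g D → offset m (suc g) ≡ offset m g + suc D → suc g < n →
                 Run D (suc (offset m g)) (suc m)
  vertical-run g D gap g+1<n = run λ t t<m+1 →
    subst₂ Joined (+-suc (offset m g) t)
      (trans (cong (_+ t) (trans gap (+-suc (offset m g) D))) (cong suc (+-swapʳ (offset m g) D t)))
      (joined-sym (joined-from-edge (vertical-step g t g+1<n (s≤s (s≤s t<m+1)))))

  -- Gaps D with 2D ≤ m: the odd diagonals 2D - 1 (horizontal) and 2D + 1
  -- (vertical) give consecutive runs of total length 2m + 3.
  small-gaps : ∀ D → 0 < D → D + D ≤ m → ∀ a → Joined a (a + D)
  small-gaps (suc q) _ 2D≤m =
    run-cover (run-append first second) (+-mono-≤ (m≤n+m m 2) (n≤1+n m))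
    where
      room : twice (suc q) ≤ m
      room = subst (_≤ m) (sym (twice-≡ (suc q))) 2D≤m
      first : Run (suc q) (offset m (suc (twice q))) (suc (suc m))
      first = horizontal-run (suc (twice q)) (suc q) (gap-odd m q)
                (s≤s (s≤s (s≤s (≤-trans (m≤n+m (twice q) 2) room))))
      continues : suc (offset m (suc (twice (suc q)))) ≡ offset m (suc (twice q)) + suc (suc m)
      continues = trans (cong (λ s → suc (offset m (suc (twice q)) + s)) (step-odd m q))
                        (sym (+-suc _ (suc m)))
      second : Run (suc q) (offset m (suc (twice q)) + suc (suc m)) (suc m)
      second = subst (λ B → Run (suc q) B (suc m)) continues
                 (vertical-run (suc (twice (suc q))) (suc q) (gap-odd m (suc q)) (s≤s (s≤s (s≤s room))))

  -- Gaps D with m < 2D < 2m, m = D + p + 1: the even diagonals 2p + 4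
  -- (horizontal) and 2p + 2 (vertical) give runs covering 2m residues.
  large-gaps : ∀ D → D < m → m < D + D → ∀ a → Joined a (a + D)
  large-gaps D D<m m<2D with m≤n⇒∃[o]m+o≡n D<m
  ... | p , e = run-cover (run-append (run-weaken D+p≤m+2 first) (run-shift continues second))
                  (≤-reflexive (sym (trans (+-suc (D + p) m) (cong (_+ m) e))))
    where
      room : suc (suc (suc (twice p))) ≤ m
      room = large-gap-room e m<2D
      first : Run D (offset m (suc (suc (twice (suc p))))) (suc (suc m))
      first = horizontal-run (suc (suc (twice (suc p)))) D (gap-even D (suc p) (trans (+-suc D p) e))
                (s≤s (s≤s (s≤s room)))
      second : Run D (suc (offset m (suc (suc (twice p))))) (suc m)
      second = vertical-run (suc (suc (twice p))) D (gap-even (suc D) p e)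
                 (s≤s (s≤s (s≤s (≤-trans (m≤n+m _ 2) room))))
      D+p≤m+2 : D + p ≤ suc (suc m)
      D+p≤m+2 = ≤-trans (subst (D + p ≤_) e (n≤1+n (D + p))) (m≤n+m m 2)
      x = offset m (suc (suc (twice p)))
      continues : suc x % k ≡ (offset m (suc (suc (twice (suc p)))) + (D + p)) % k
      continues = sym (begin
        (x + step m (suc (suc (twice p))) + (D + p)) % k ≡⟨ cong (λ s → (x + s + (D + p)) % k) (step-even m p) ⟩
        (x + suc (suc m) + (D + p)) % k                  ≡⟨ cong (_% k) (large-gap-wrap x {D} {p} e) ⟩
        (suc x + k) % k                                   ≡⟨ [m+n]%n≡m%n (suc x) k ⟩
        suc x % k                                         ∎)
        where open ≡-Reasoning

  -- The gap m: diagonal 2 gives a run of gap m from 1, and read backwards from 1 + m.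
  half-gap : ∀ a → Joined a (a + m)
  half-gap = run-cover (run-append (run-weaken (m≤n+m m 2) first) second)
                       (+-monoʳ-≤ m (m≤n+m m 2))
    where
      first : Run m 1 (suc (suc m))
      first = horizontal-run 2 m refl (s≤s (s≤s (s≤s (s≤s z≤n))))
      second : Run m (1 + m) (suc (suc m))
      second = subst (λ D → Run D (1 + m) (suc (suc m))) (m+n∸n≡m m m) (run-flip (m≤m+n m m) first)

  all-gaps : ∀ D → 0 < D → D + D ≤ k → ∀ a → Joined a (a + D)
  all-gaps D 0<D 2D≤k with <-cmp D m
  ... | tri> _ _ m<D = ⊥-elim (<⇒≱ (+-mono-< m<D m<D) 2D≤k)
  ... | tri≈ _ refl _ = half-gap
  ... | tri< D<m _ _ with D + D ≤? m
  ...   | yes 2D≤m = small-gaps D 0<D 2D≤m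
  ...   | no 2D≰m = large-gaps D D<m (≰⇒> 2D≰m)

  complete : IsCompleteColoring n k colour
  complete = complete-from-gaps all-gaps

grid-bound : ∀ m′ → ΓAtLeast (suc (suc (suc (suc m′)))) (suc m′ + suc m′)
grid-bound m′ = k , ≤-refl , colour , complete
  where open Construction m′

one-colour : ∀ n → ΓAtLeast n 1
one-colour n = 1 , ≤-refl , (λ _ → Data.Fin.zero) , λ { Data.Fin.zero Data.Fin.zero 0≢0 → ⊥-elim (0≢0 refl) }

Γ-mono : ∀ {n x y} → x ≤ y → ΓAtLeast n y → ΓAtLeast n x
Γ-mono x≤y (k , y≤k , c , complete) = k , ≤-trans x≤y y≤k , c , complete

bound-≤ : ∀ n → bound n ≤ 2 * n ∸ 6
bound-≤ n with n % 4
... | 0 = ≤-refl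
... | 1 = ≤-refl
... | 2 = ∸-monoʳ-≤ (2 * n) (n≤1+n 6)
... | suc (suc (suc _)) = ∸-monoʳ-≤ (2 * n) (m≤n+m 6 3)

two-n-minus-six : ∀ m′ → 2 * suc (suc (suc (suc m′))) ∸ 6 ≡ suc m′ + suc m′
two-n-minus-six m′ = trans (cong (_∸ 6) (identity m′)) (m+n∸m≡n 6 (suc m′ + suc m′))
  where
    identity : ∀ m′ → 2 * suc (suc (suc (suc m′))) ≡ 6 + (suc m′ + suc m′)
    identity = solve-∀

theorem2 : (n : ℕ) → 2 ≤ n → ΓAtLeast n (2 * n ∸ 9) × ΓAtLeast n (bound n)
theorem2 (suc zero) (s≤s ())
theorem2 (suc (suc zero)) _ = Γ-mono z≤n (one-colour 2) , Γ-mono z≤n (one-colour 2)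
theorem2 (suc (suc (suc zero))) _ = Γ-mono z≤n (one-colour 3) , Γ-mono z≤n (one-colour 3)
theorem2 n@(suc (suc (suc (suc m′)))) _ =
  Γ-mono (≤-trans (∸-monoʳ-≤ (2 * n) (m≤n+m 6 3)) ≤2m) (grid-bound m′) ,
  Γ-mono (≤-trans (bound-≤ n) ≤2m) (grid-bound m′)
  where
    ≤2m : 2 * n ∸ 6 ≤ suc m′ + suc m′
    ≤2m = ≤-reflexive (two-n-minus-six m′)
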